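{- Let $a,b,c$ be commuting indeterminates and $D_3,D_4$ the derivations of $\mathbb Q[a,b,c]$ with $D_3(a)=c$, $D_3(b)=2c$, $D_3(c)=bc$ and $D_4(a)=ac$, $D_4(b)=2ac$, $D_4(c)=abc$. For $n\ge1$ let $s_n(i,j)$ be the coefficient of $a^ic^jb^{3n+1-i-2j}$ in $(D_4D_3)^n(a)$ and $t_n(i,j)$ the coefficient of $a^ic^jb^{3n-1-i-2j}$ in $D_3(D_4D_3)^{n-1}(a)$ (where $(D_4D_3)^n$ is $n$-fold application of $D_3$ followed by $D_4$). Then for $n\ge1$, $$s_n(i,j)=i\,t_n(i,j-1)+j\,t_n(i-1,j)+2(3n+2-i-2j)t_n(i-1,j-1),$$ $$t_{n+1}(i,j)=(i+1)s_n(i+1,j-1)+j\,s_n(i,j)+2(3n+3-i-2j)s_n(i,j-1),$$ with $t_1(0,1)=1$ and $t_1(i,j)=0$ for $(i,j)\ne(0,1)$. Equivalently, with $s_n(x,y)=\sum_{i,j}s_n(i,j)x^iy^j$ and $t_n(x,y)=\sum_{i,j}t_n(i,j)x^iy^j$, $$s_n(x,y)=2(3n-1)xy\,t_n(x,y)+xy(1-2x)\frac{\partial}{\partial x}t_n(x,y)+xy(1-4y)\frac{\partial}{\partial y}t_n(x,y),$$ $$t_{n+1}(x,y)=2(3n+1)y\,s_n(x,y)+y(1-2x)\frac{\partial}{\partial x}s_n(x,y)+y(1-4y)\frac{\partial}{\partial y}s_n(x,y),$$ with $t_1(x,y)=y$. -}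

module Defs where

open import Data.Nat as ℕ using (ℕ; zero; suc)
open import Data.Integer as ℤ using (ℤ; +_; -[1+_])
open import Data.Rational as ℚ using (ℚ; 0ℚ; 1ℚ; _/_)
open import Data.Product using (_×_; _,_)
open import Data.List using (List; []; _∷_; _++_; map; concatMap; upTo)
open import Data.Bool using (if_then_else_; _∧_)
open import Relation.Nullary.Decidable using (⌊_⌋)
open import Relation.Binary.PropositionalEquality using (_≡_)

ℕtoℚ : ℕ → ℚ
ℕtoℚ n = (+ n) / 1

ℤtoℚ : ℤ → ℚ
ℤtoℚ z = z / 1

-- ℚ[a,b,c] : sparse polynomials = finite lists of terms (coefficient,
-- exponents of a, b, c).  Two lists denote the same polynomial iff all
-- their coefficients agree (_≈P_).

Mono : Set
Mono = ℕ × ℕ × ℕ            -- (exponent of a , exponent of b , exponent of c)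

Poly : Set
Poly = List (ℚ × Mono)

coeff : Poly → ℕ → ℕ → ℕ → ℚ
coeff [] i k j = 0ℚ
coeff ((q , (i' , k' , j')) ∷ p) i k j =
  (if ⌊ i ℕ.≟ i' ⌋ ∧ ⌊ k ℕ.≟ k' ⌋ ∧ ⌊ j ℕ.≟ j' ⌋ then q else 0ℚ) ℚ.+ coeff p i k j

_≈P_ : Poly → Poly → Set
p ≈P q = ∀ i k j → coeff p i k j ≡ coeff q i k j

var-a var-b var-c : Poly
var-a = (1ℚ , (1 , 0 , 0)) ∷ []
var-b = (1ℚ , (0 , 1 , 0)) ∷ []
var-c = (1ℚ , (0 , 0 , 1)) ∷ []

scaleP : ℚ → Poly → Poly
scaleP r = map (λ { (q , m) → (r ℚ.* q , m) })

_*P_ : Poly → Poly → Poly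
p *P q = concatMap (λ { (r , (i , k , j)) →
           map (λ { (s , (i' , k' , j')) → (r ℚ.* s , (i ℕ.+ i' , k ℕ.+ k' , j ℕ.+ j')) }) q }) p

∂a ∂b ∂c : Poly → Poly
∂a = map (λ { (q , (i , k , j)) → (ℕtoℚ i ℚ.* q , (i ℕ.∸ 1 , k , j)) })
∂b = map (λ { (q , (i , k , j)) → (ℕtoℚ k ℚ.* q , (i , k ℕ.∸ 1 , j)) })
∂c = map (λ { (q , (i , k , j)) → (ℕtoℚ j ℚ.* q , (i , k , j ℕ.∸ 1)) })

-- the (unique) derivation D of ℚ[a,b,c] with D(a) = Pa, D(b) = Pb, D(c) = Pc:
-- D(p) = ∂p/∂a · Pa + ∂p/∂b · Pb + ∂p/∂c · Pc
derivation : Poly → Poly → Poly → Poly → Poly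
derivation Pa Pb Pc p = (∂a p *P Pa) ++ ((∂b p *P Pb) ++ (∂c p *P Pc))

D3 : Poly → Poly
D3 = derivation var-c (scaleP (ℕtoℚ 2) var-c) (var-b *P var-c)

D4 : Poly → Poly
D4 = derivation (var-a *P var-c) (scaleP (ℕtoℚ 2) (var-a *P var-c))
                ((var-a *P var-b) *P var-c)

D43^ : ℕ → Poly → Poly
D43^ zero p = p
D43^ (suc n) p = D4 (D3 (D43^ n p))

coeffℤ : Poly → ℤ → ℤ → ℤ → ℚ
coeffℤ p (+ i) (+ k) (+ j) = coeff p i k j
coeffℤ p _ _ _ = 0ℚ

s : ℕ → ℤ → ℤ → ℚ
s n i j = coeffℤ (D43^ n var-a) i (+ (3 ℕ.* n ℕ.+ 1) ℤ.- i ℤ.- (+ 2) ℤ.* j) j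

t : ℕ → ℤ → ℤ → ℚ
t n i j = coeffℤ (D3 (D43^ (n ℕ.∸ 1) var-a)) i (+ (3 ℕ.* n) ℤ.- (+ 1) ℤ.- i ℤ.- (+ 2) ℤ.* j) j

infixl 6 _+P2_
infixl 7 _*P2_
infixl 7 _*P_
infix 4 _≈P_ _≈P2_

Poly2 : Set
Poly2 = List (ℚ × ℕ × ℕ)     -- (coefficient , exponent of x , exponent of y)

coeff2 : Poly2 → ℕ → ℕ → ℚ
coeff2 [] i j = 0ℚ
coeff2 ((q , i' , j') ∷ p) i j =
  (if ⌊ i ℕ.≟ i' ⌋ ∧ ⌊ j ℕ.≟ j' ⌋ then q else 0ℚ) ℚ.+ coeff2 p i j

_≈P2_ : Poly2 → Poly2 → Set
p ≈P2 q = ∀ i j → coeff2 p i j ≡ coeff2 q i j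

const2 : ℚ → Poly2
const2 q = (q , 0 , 0) ∷ []

var-x var-y : Poly2
var-x = (1ℚ , 1 , 0) ∷ []
var-y = (1ℚ , 0 , 1) ∷ []

_+P2_ : Poly2 → Poly2 → Poly2
_+P2_ = _++_

_*P2_ : Poly2 → Poly2 → Poly2
p *P2 q = concatMap (λ { (r , i , j) →
            map (λ { (s' , i' , j') → (r ℚ.* s' , i ℕ.+ i' , j ℕ.+ j') }) q }) p

∂x ∂y : Poly2 → Poly2
∂x = map (λ { (q , i , j) → (ℕtoℚ i ℚ.* q , i ℕ.∸ 1 , j) })
∂y = map (λ { (q , i , j) → (ℕtoℚ j ℚ.* q , i , j ℕ.∸ 1) })

-- generating polynomial Σ_{i,j} f(i,j) x^i y^j; for the families s_n, t_n
-- all nonzero coefficients have 0 ≤ i, j ≤ 3n+1, so summing over that box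
-- is the full (finite) sum.
genPoly : ℕ → (ℤ → ℤ → ℚ) → Poly2
genPoly N f = concatMap (λ i → map (λ j → (f (+ i) (+ j) , i , j)) (upTo (suc N))) (upTo (suc N))

sPoly tPoly : ℕ → Poly2
sPoly n = genPoly (3 ℕ.* n ℕ.+ 1) (s n)
tPoly n = genPoly (3 ℕ.* n ℕ.+ 1) (t n)

-- Give a, b weight 1 and c weight 2. Then D3 raises weight by 1 and D4 by 2, so s n and t n are
-- the coefficients of the weight 3n+1 and 3n-1 components, with the b-exponent fixed by the weight.
-- A derivation acts as D p = ∂a p · D a + ∂b p · D b + ∂c p · D c, and D3, D4 send a, b, c to
-- monomials; reading off one coefficient of each summand gives the recurrences, the factor
-- 2(3n+2-i-2j) being the b-exponent brought down by ∂b times the 2 in D(b). The identities for the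
-- generating polynomials are the same recurrences read coefficientwise: x^u y^v shifts coefficients
-- and ∂x, ∂y multiply them by the exponent. Every coefficient is computed as a sum over the term list
-- of products of Kronecker deltas, on which these operations become index shifts.

module Submission where

open import Defs
open import Data.Nat using (ℕ; suc; _≥_; _+_; _*_; _∸_)
open import Data.Integer using (ℤ; +_; _-_)
open import Data.Rational using (ℚ; 0ℚ; 1ℚ)
import Data.Rational as Q
import Data.Integer as Z
open import Data.Product using (_×_)
open import Relation.Nullary using (¬_)
open import Relation.Binary.PropositionalEquality using (_≡_)

open import Data.Bool using (Bool; true; false; if_then_else_; _∧_)
open import Data.Empty using (⊥-elim)
open import Data.Integer using (-[1+_]; 0ℤ)
open import Data.Integer.Tactic.RingSolver using (solve-∀)
open import Data.List using (List; []; _∷_; _++_; map; concatMap; upTo)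
open import Data.Nat as N using (zero; _<_; _≤_)
open import Data.Product using (_,_)
open import Data.Rational.Solver using (module +-*-Solver)
open import Data.Sum using (_⊎_; inj₁; inj₂)
open import Relation.Binary.PropositionalEquality using (_≢_; refl; subst; sym; trans; cong; cong₂; module ≡-Reasoning)
open import Relation.Nullary using (yes; no)
open import Relation.Nullary.Decidable using (⌊_⌋; isYes≗does)
import Data.Integer.Properties as ZP
import Data.List.Properties as LP
import Data.Nat.Properties as NP
import Data.Rational.Properties as QP
import Data.Rational.Unnormalised as U
import Data.Rational.Unnormalised.Properties as UP

open +-*-Solver using (solve; _:+_; _:*_; _:=_)
open ≡-Reasoning

private
  variable
    A : Set


∑ : (A → ℚ) → List A → ℚ
∑ f [] = 0ℚ
∑ f (x ∷ xs) = f x Q.+ ∑ f xs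

∑-++ : ∀ (f : A → ℚ) xs ys → ∑ f (xs ++ ys) ≡ ∑ f xs Q.+ ∑ f ys
∑-++ f [] ys = sym (QP.+-identityˡ (∑ f ys))
∑-++ f (x ∷ xs) ys = trans (cong (f x Q.+_) (∑-++ f xs ys)) (sym (QP.+-assoc (f x) (∑ f xs) (∑ f ys)))

∑-cong : ∀ {f g : A → ℚ} → (∀ x → f x ≡ g x) → ∀ xs → ∑ f xs ≡ ∑ g xs
∑-cong h [] = refl
∑-cong h (x ∷ xs) = cong₂ Q._+_ (h x) (∑-cong h xs)

∑-zero : ∀ {f : A → ℚ} → (∀ x → f x ≡ 0ℚ) → ∀ xs → ∑ f xs ≡ 0ℚ
∑-zero h [] = refl
∑-zero h (x ∷ xs) = trans (cong₂ Q._+_ (h x) (∑-zero h xs)) (QP.+-identityˡ 0ℚ)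

∑-*ˡ : ∀ c (f : A → ℚ) xs → ∑ (λ x → c Q.* f x) xs ≡ c Q.* ∑ f xs
∑-*ˡ c f [] = sym (QP.*-zeroʳ c)
∑-*ˡ c f (x ∷ xs) = trans (cong (c Q.* f x Q.+_) (∑-*ˡ c f xs)) (sym (QP.*-distribˡ-+ c (f x) (∑ f xs)))

∑-map : ∀ {B : Set} (f : B → ℚ) (g : A → B) xs → ∑ f (map g xs) ≡ ∑ (λ x → f (g x)) xs
∑-map f g [] = refl
∑-map f g (x ∷ xs) = cong (f (g x) Q.+_) (∑-map f g xs)

∑-concatMap : ∀ {B : Set} (f : B → ℚ) (g : A → List B) xs → ∑ f (concatMap g xs) ≡ ∑ (λ x → ∑ f (g x)) xs
∑-concatMap f g [] = refl
∑-concatMap f g (x ∷ xs) = trans (∑-++ f (g x) (concatMap g xs)) (cong (∑ f (g x) Q.+_) (∑-concatMap f g xs))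

*-≡0ʳ : ∀ x {y} → y ≡ 0ℚ → x Q.* y ≡ 0ℚ
*-≡0ʳ x refl = QP.*-zeroʳ x


𝟙 : Bool → ℚ
𝟙 b = if b then 1ℚ else 0ℚ

if-then-0 : ∀ b q → (if b then q else 0ℚ) ≡ 𝟙 b Q.* q
if-then-0 true q = sym (QP.*-identityˡ q)
if-then-0 false q = sym (QP.*-zeroˡ q)

if-∧-then-0 : ∀ b c q → (if b ∧ c then q else 0ℚ) ≡ 𝟙 b Q.* (if c then q else 0ℚ)
if-∧-then-0 true c q = sym (QP.*-identityˡ _)
if-∧-then-0 false c q = sym (QP.*-zeroˡ (if c then q else 0ℚ))

δ : ℤ → ℕ → ℚ
δ (+ a) i = 𝟙 ⌊ a N.≟ i ⌋
δ -[1+ _ ] i = 0ℚ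

δ-*-cong : ∀ I i {x y} → (I ≡ + i → x ≡ y) → δ I i Q.* x ≡ δ I i Q.* y
δ-*-cong (+ a) i {x} {y} h with a N.≟ i
... | yes refl = cong (1ℚ Q.*_) (h refl)
... | no _ = trans (QP.*-zeroˡ x) (sym (QP.*-zeroˡ y))
δ-*-cong -[1+ _ ] i {x} {y} h = trans (QP.*-zeroˡ x) (sym (QP.*-zeroˡ y))

δ-suc : ∀ I i → δ I (suc i) ≡ δ (I - + 1) i
δ-suc (+ zero) i = refl
δ-suc (+ suc a) i = cong 𝟙 (trans (isYes≗does (suc a N.≟ suc i)) (sym (isYes≗does (a N.≟ i))))
δ-suc -[1+ _ ] i = refl

δ-diagonal : ∀ a → δ (+ a) a ≡ 1ℚ
δ-diagonal a with a N.≟ a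
... | yes _ = refl
... | no a≢a = ⊥-elim (a≢a refl)

δ-off-diagonal : ∀ {a i} → a ≢ i → δ (+ a) i ≡ 0ℚ
δ-off-diagonal {a} {i} a≢i with a N.≟ i
... | yes a≡i = ⊥-elim (a≢i a≡i)
... | no _ = refl

-- Lowering by a literal computes to iterated `_ - + 1`, the form in which shifted indices occur.
_↓_ : ℤ → ℕ → ℤ
I ↓ zero = I
I ↓ suc u = (I - + 1) ↓ u

δ-+ : ∀ I u i → δ I (u + i) ≡ δ (I ↓ u) i
δ-+ I zero i = refl
δ-+ I (suc u) i = trans (δ-suc I (u + i)) (δ-+ (I - + 1) u i)

δ-+ʳ : ∀ I u i → δ I (i + u) ≡ δ (I ↓ u) i
δ-+ʳ I u i = trans (cong (δ I) (NP.+-comm i u)) (δ-+ I u i)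

i-1+1≡i : ∀ I → I - + 1 Z.+ + 1 ≡ I
i-1+1≡i = solve-∀

i+1-1≡i : ∀ I → I Z.+ + 1 - + 1 ≡ I
i+1-1≡i = solve-∀

-- When i = 0 the truncated exponent i ∸ 1 is harmless: the term then carries the factor ℕtoℚ 0.
δ-pred-* : ∀ I i → δ I (i ∸ 1) Q.* ℕtoℚ i ≡ ℤtoℚ (I Z.+ + 1) Q.* δ (I Z.+ + 1) i
δ-pred-* I zero = begin
  δ I 0 Q.* 0ℚ                         ≡⟨ QP.*-zeroʳ (δ I 0) ⟩
  0ℚ                                   ≡⟨ QP.*-zeroʳ (δ (I Z.+ + 1) 0) ⟨
  δ (I Z.+ + 1) 0 Q.* ℤtoℚ (+ 0)       ≡⟨ δ-*-cong (I Z.+ + 1) 0 (λ e → cong ℤtoℚ (sym e)) ⟩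
  δ (I Z.+ + 1) 0 Q.* ℤtoℚ (I Z.+ + 1) ≡⟨ QP.*-comm (δ (I Z.+ + 1) 0) _ ⟩
  ℤtoℚ (I Z.+ + 1) Q.* δ (I Z.+ + 1) 0 ∎
δ-pred-* I (suc i) = begin
  δ I i Q.* ℕtoℚ (suc i)                     ≡⟨ δ-*-cong I i (λ e → cong ℤtoℚ (suc≡+1 e)) ⟩
  δ I i Q.* ℤtoℚ (I Z.+ + 1)                 ≡⟨ cong (λ K → δ K i Q.* ℤtoℚ (I Z.+ + 1)) (i+1-1≡i I) ⟨
  δ (I Z.+ + 1 - + 1) i Q.* ℤtoℚ (I Z.+ + 1) ≡⟨ cong (Q._* ℤtoℚ (I Z.+ + 1)) (δ-suc (I Z.+ + 1) i) ⟨
  δ (I Z.+ + 1) (suc i) Q.* ℤtoℚ (I Z.+ + 1) ≡⟨ QP.*-comm (δ (I Z.+ + 1) (suc i)) _ ⟩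
  ℤtoℚ (I Z.+ + 1) Q.* δ (I Z.+ + 1) (suc i) ∎
  where
  suc≡+1 : I ≡ + i → + suc i ≡ I Z.+ + 1
  suc≡+1 refl = trans (cong +_ (NP.+-comm 1 i)) (ZP.pos-+ i 1)

∑-upTo-suc : ∀ (f : ℕ → ℚ) n → ∑ f (upTo (suc n)) ≡ ∑ f (upTo n) Q.+ f n
∑-upTo-suc f n = begin
  ∑ f (upTo (suc n))              ≡⟨ cong (∑ f) (LP.upTo-∷ʳ n) ⟨
  ∑ f (upTo n ++ n ∷ [])          ≡⟨ ∑-++ f (upTo n) (n ∷ []) ⟩
  ∑ f (upTo n) Q.+ (f n Q.+ 0ℚ)   ≡⟨ cong (∑ f (upTo n) Q.+_) (QP.+-identityʳ (f n)) ⟩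
  ∑ f (upTo n) Q.+ f n            ∎

∑-δ-upTo-≥ : ∀ n {a} (g : ℕ → ℚ) → n ≤ a → ∑ (λ i → δ (+ a) i Q.* g i) (upTo n) ≡ 0ℚ
∑-δ-upTo-≥ zero g _ = refl
∑-δ-upTo-≥ (suc n) {a} g n<a = begin
  ∑ (λ i → δ (+ a) i Q.* g i) (upTo (suc n))
    ≡⟨ ∑-upTo-suc (λ i → δ (+ a) i Q.* g i) n ⟩
  ∑ (λ i → δ (+ a) i Q.* g i) (upTo n) Q.+ δ (+ a) n Q.* g n
    ≡⟨ cong₂ Q._+_ (∑-δ-upTo-≥ n g (NP.<⇒≤ n<a)) (cong (Q._* g n) (δ-off-diagonal a≢n)) ⟩
  0ℚ Q.+ 0ℚ Q.* g n
    ≡⟨ trans (QP.+-identityˡ _) (QP.*-zeroˡ (g n)) ⟩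
  0ℚ ∎
  where
  a≢n : a ≢ n
  a≢n a≡n = NP.<-irrefl (sym a≡n) n<a

∑-δ-upTo-< : ∀ n {a} (g : ℕ → ℚ) → a < n → ∑ (λ i → δ (+ a) i Q.* g i) (upTo n) ≡ g a
∑-δ-upTo-< (suc n) {a} g a<1+n = trans (∑-upTo-suc (λ i → δ (+ a) i Q.* g i) n) (last (NP.m<1+n⇒m<n∨m≡n a<1+n))
  where
  last : a < n ⊎ a ≡ n → ∑ (λ i → δ (+ a) i Q.* g i) (upTo n) Q.+ δ (+ a) n Q.* g n ≡ g a
  last (inj₁ a<n) = begin
    ∑ (λ i → δ (+ a) i Q.* g i) (upTo n) Q.+ δ (+ a) n Q.* g n
      ≡⟨ cong₂ Q._+_ (∑-δ-upTo-< n g a<n) (cong (Q._* g n) (δ-off-diagonal (NP.<⇒≢ a<n))) ⟩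
    g a Q.+ 0ℚ Q.* g n
      ≡⟨ trans (cong (g a Q.+_) (QP.*-zeroˡ (g n))) (QP.+-identityʳ (g a)) ⟩
    g a ∎
  last (inj₂ refl) = begin
    ∑ (λ i → δ (+ a) i Q.* g i) (upTo a) Q.+ δ (+ a) a Q.* g a
      ≡⟨ cong₂ Q._+_ (∑-δ-upTo-≥ a g NP.≤-refl) (cong (Q._* g a) (δ-diagonal a)) ⟩
    0ℚ Q.+ 1ℚ Q.* g a
      ≡⟨ trans (QP.+-identityˡ _) (QP.*-identityˡ (g a)) ⟩
    g a ∎

∑-δ-upTo : ∀ n a (g : ℕ → ℚ) → (n ≤ a → g a ≡ 0ℚ) → ∑ (λ i → δ (+ a) i Q.* g i) (upTo n) ≡ g a
∑-δ-upTo n a g vanish with a N.<? n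
... | yes a<n = ∑-δ-upTo-< n g a<n
... | no a≮n = trans (∑-δ-upTo-≥ n g (NP.≮⇒≥ a≮n)) (sym (vanish (NP.≮⇒≥ a≮n)))

toℚᵘ-ℤtoℚ : ∀ z → Q.toℚᵘ (ℤtoℚ z) U.≃ U.mkℚᵘ z 0
toℚᵘ-ℤtoℚ z = QP.toℚᵘ-fromℚᵘ (U.mkℚᵘ z 0)

ℤtoℚ-+ : ∀ a b → ℤtoℚ (a Z.+ b) ≡ ℤtoℚ a Q.+ ℤtoℚ b
ℤtoℚ-+ a b = QP.toℚᵘ-injective (UP.≃-trans (toℚᵘ-ℤtoℚ (a Z.+ b)) (UP.≃-sym
  (UP.≃-trans (QP.toℚᵘ-homo-+ (ℤtoℚ a) (ℤtoℚ b))
  (UP.≃-trans (UP.+-cong (toℚᵘ-ℤtoℚ a) (toℚᵘ-ℤtoℚ b)) (U.*≡* (denominators a b))))))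
  where
  denominators : ∀ a b → (a Z.* + 1 Z.+ b Z.* + 1) Z.* + 1 ≡ (a Z.+ b) Z.* (+ 1 Z.* + 1)
  denominators = solve-∀

ℤtoℚ-* : ∀ a b → ℤtoℚ (a Z.* b) ≡ ℤtoℚ a Q.* ℤtoℚ b
ℤtoℚ-* a b = QP.toℚᵘ-injective (UP.≃-trans (toℚᵘ-ℤtoℚ (a Z.* b)) (UP.≃-sym
  (UP.≃-trans (QP.toℚᵘ-homo-* (ℤtoℚ a) (ℤtoℚ b))
  (UP.≃-trans (UP.*-cong (toℚᵘ-ℤtoℚ a) (toℚᵘ-ℤtoℚ b)) (U.*≡* (denominators a b))))))
  where
  denominators : ∀ a b → a Z.* b Z.* + 1 ≡ a Z.* b Z.* (+ 1 Z.* + 1)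
  denominators = solve-∀

twice-ℤtoℚ : ∀ k → ℕtoℚ 2 Q.* ℤtoℚ k ≡ ℤtoℚ (+ 2 Z.* k)
twice-ℤtoℚ k = sym (ℤtoℚ-* (+ 2) k)

ℤtoℚ-linear : ∀ γ X Y →
  ℤtoℚ γ Q.+ Q.- ℕtoℚ 2 Q.* ℤtoℚ X Q.+ Q.- ℕtoℚ 4 Q.* ℤtoℚ Y ≡ ℤtoℚ (γ - + 2 Z.* X - + 4 Z.* Y)
ℤtoℚ-linear γ X Y = begin
  ℤtoℚ γ Q.+ ℤtoℚ -[1+ 1 ] Q.* ℤtoℚ X Q.+ ℤtoℚ -[1+ 3 ] Q.* ℤtoℚ Y
    ≡⟨ cong₂ (λ x y → ℤtoℚ γ Q.+ x Q.+ y) (ℤtoℚ-* -[1+ 1 ] X) (ℤtoℚ-* -[1+ 3 ] Y) ⟨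
  ℤtoℚ γ Q.+ ℤtoℚ (-[1+ 1 ] Z.* X) Q.+ ℤtoℚ (-[1+ 3 ] Z.* Y)
    ≡⟨ cong (Q._+ ℤtoℚ (-[1+ 3 ] Z.* Y)) (ℤtoℚ-+ γ (-[1+ 1 ] Z.* X)) ⟨
  ℤtoℚ (γ Z.+ -[1+ 1 ] Z.* X) Q.+ ℤtoℚ (-[1+ 3 ] Z.* Y)
    ≡⟨ ℤtoℚ-+ (γ Z.+ -[1+ 1 ] Z.* X) (-[1+ 3 ] Z.* Y) ⟨
  ℤtoℚ (γ Z.+ -[1+ 1 ] Z.* X Z.+ -[1+ 3 ] Z.* Y)
    ≡⟨ cong ℤtoℚ (negate γ X Y) ⟩
  ℤtoℚ (γ - + 2 Z.* X - + 4 Z.* Y) ∎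
  where
  negate : ∀ γ X Y → γ Z.+ -[1+ 1 ] Z.* X Z.+ -[1+ 3 ] Z.* Y ≡ γ - + 2 Z.* X - + 4 Z.* Y
  negate = solve-∀


-- Coefficients in ℚ[a,b,c]

termCoeff : ℤ → ℤ → ℤ → ℚ × Mono → ℚ
termCoeff I K J (q , i , k , j) = δ I i Q.* (δ K k Q.* (δ J j Q.* q))

coeffℤ-∑ : ∀ p I K J → coeffℤ p I K J ≡ ∑ (termCoeff I K J) p
coeffℤ-∑ [] (+ _) (+ _) (+ _) = refl
coeffℤ-∑ ((q , i′ , k′ , j′) ∷ p) (+ i) (+ k) (+ j) = cong₂ Q._+_ selector (coeffℤ-∑ p (+ i) (+ k) (+ j))
  where
  selector : (if ⌊ i N.≟ i′ ⌋ ∧ ⌊ k N.≟ k′ ⌋ ∧ ⌊ j N.≟ j′ ⌋ then q else 0ℚ)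
             ≡ termCoeff (+ i) (+ k) (+ j) (q , i′ , k′ , j′)
  selector = begin
    (if ⌊ i N.≟ i′ ⌋ ∧ ⌊ k N.≟ k′ ⌋ ∧ ⌊ j N.≟ j′ ⌋ then q else 0ℚ)
      ≡⟨ if-∧-then-0 ⌊ i N.≟ i′ ⌋ _ q ⟩
    δ (+ i) i′ Q.* (if ⌊ k N.≟ k′ ⌋ ∧ ⌊ j N.≟ j′ ⌋ then q else 0ℚ)
      ≡⟨ cong (δ (+ i) i′ Q.*_) (if-∧-then-0 ⌊ k N.≟ k′ ⌋ _ q) ⟩
    δ (+ i) i′ Q.* (δ (+ k) k′ Q.* (if ⌊ j N.≟ j′ ⌋ then q else 0ℚ))
      ≡⟨ cong (λ x → δ (+ i) i′ Q.* (δ (+ k) k′ Q.* x)) (if-then-0 ⌊ j N.≟ j′ ⌋ q) ⟩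
    termCoeff (+ i) (+ k) (+ j) (q , i′ , k′ , j′) ∎
coeffℤ-∑ p -[1+ _ ] K J = sym (∑-zero (λ { (q , i , k , j) → QP.*-zeroˡ (δ K k Q.* (δ J j Q.* q)) }) p)
coeffℤ-∑ p (+ i) -[1+ _ ] J = sym (∑-zero (λ { (q , i′ , k , j) → *-≡0ʳ (δ (+ i) i′) (QP.*-zeroˡ (δ J j Q.* q)) }) p)
coeffℤ-∑ p (+ i) (+ k) -[1+ _ ] =
  sym (∑-zero (λ { (q , i′ , k′ , j) → *-≡0ʳ (δ (+ i) i′) (*-≡0ʳ (δ (+ k) k′) (QP.*-zeroˡ q)) }) p)

coeffℤ-++ : ∀ p p′ I K J → coeffℤ (p ++ p′) I K J ≡ coeffℤ p I K J Q.+ coeffℤ p′ I K J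
coeffℤ-++ p p′ I K J = begin
  coeffℤ (p ++ p′) I K J                                  ≡⟨ coeffℤ-∑ (p ++ p′) I K J ⟩
  ∑ (termCoeff I K J) (p ++ p′)                           ≡⟨ ∑-++ (termCoeff I K J) p p′ ⟩
  ∑ (termCoeff I K J) p Q.+ ∑ (termCoeff I K J) p′        ≡⟨ cong₂ Q._+_ (coeffℤ-∑ p I K J) (coeffℤ-∑ p′ I K J) ⟨
  coeffℤ p I K J Q.+ coeffℤ p′ I K J                      ∎

termCoeff-shift : ∀ I K J r u v w q i k j →
  termCoeff I K J (q Q.* r , i + u , k + v , j + w) ≡ termCoeff (I ↓ u) (K ↓ v) (J ↓ w) (q , i , k , j) Q.* r
termCoeff-shift I K J r u v w q i k j = begin
  δ I (i + u) Q.* (δ K (k + v) Q.* (δ J (j + w) Q.* (q Q.* r)))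
    ≡⟨ cong₂ (λ a x → a Q.* x) (δ-+ʳ I u i) (cong₂ (λ b c → b Q.* (c Q.* (q Q.* r))) (δ-+ʳ K v k) (δ-+ʳ J w j)) ⟩
  δ (I ↓ u) i Q.* (δ (K ↓ v) k Q.* (δ (J ↓ w) j Q.* (q Q.* r)))
    ≡⟨ solve 5 (λ a b c q r → a :* (b :* (c :* (q :* r))) := (a :* (b :* (c :* q))) :* r) refl
         (δ (I ↓ u) i) (δ (K ↓ v) k) (δ (J ↓ w) j) q r ⟩
  δ (I ↓ u) i Q.* (δ (K ↓ v) k Q.* (δ (J ↓ w) j Q.* q)) Q.* r ∎

coeffℤ-*-monomial : ∀ p r u v w I K J →
  coeffℤ (p *P ((r , u , v , w) ∷ [])) I K J ≡ coeffℤ p (I ↓ u) (K ↓ v) (J ↓ w) Q.* r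
coeffℤ-*-monomial p r u v w I K J = begin
  coeffℤ (p *P ((r , u , v , w) ∷ [])) I K J       ≡⟨ coeffℤ-∑ (p *P ((r , u , v , w) ∷ [])) I K J ⟩
  ∑ (termCoeff I K J) (p *P ((r , u , v , w) ∷ [])) ≡⟨ shifted p ⟩
  ∑ (termCoeff (I ↓ u) (K ↓ v) (J ↓ w)) p Q.* r     ≡⟨ cong (Q._* r) (coeffℤ-∑ p (I ↓ u) (K ↓ v) (J ↓ w)) ⟨
  coeffℤ p (I ↓ u) (K ↓ v) (J ↓ w) Q.* r            ∎
  where
  shifted : ∀ p → ∑ (termCoeff I K J) (p *P ((r , u , v , w) ∷ [])) ≡ ∑ (termCoeff (I ↓ u) (K ↓ v) (J ↓ w)) p Q.* r
  shifted [] = sym (QP.*-zeroˡ r)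
  shifted ((q , i , k , j) ∷ p) =
    trans (cong₂ Q._+_ (termCoeff-shift I K J r u v w q i k j) (shifted p))
          (sym (QP.*-distribʳ-+ r (termCoeff (I ↓ u) (K ↓ v) (J ↓ w) (q , i , k , j)) (∑ (termCoeff (I ↓ u) (K ↓ v) (J ↓ w)) p)))

coeffℤ-map : ∀ (g : ℚ × Mono → ℚ × Mono) c I K J I′ K′ J′ →
  (∀ x → termCoeff I K J (g x) ≡ c Q.* termCoeff I′ K′ J′ x) →
  ∀ p → coeffℤ (map g p) I K J ≡ c Q.* coeffℤ p I′ K′ J′
coeffℤ-map g c I K J I′ K′ J′ scaled p = begin
  coeffℤ (map g p) I K J                         ≡⟨ coeffℤ-∑ (map g p) I K J ⟩
  ∑ (termCoeff I K J) (map g p)                  ≡⟨ ∑-map (termCoeff I K J) g p ⟩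
  ∑ (λ x → termCoeff I K J (g x)) p              ≡⟨ ∑-cong scaled p ⟩
  ∑ (λ x → c Q.* termCoeff I′ K′ J′ x) p         ≡⟨ ∑-*ˡ c (termCoeff I′ K′ J′) p ⟩
  c Q.* ∑ (termCoeff I′ K′ J′) p                 ≡⟨ cong (c Q.*_) (coeffℤ-∑ p I′ K′ J′) ⟨
  c Q.* coeffℤ p I′ K′ J′                        ∎

coeffℤ-∂a : ∀ p I K J → coeffℤ (∂a p) I K J ≡ ℤtoℚ (I Z.+ + 1) Q.* coeffℤ p (I Z.+ + 1) K J
coeffℤ-∂a p I K J = coeffℤ-map _ (ℤtoℚ (I Z.+ + 1)) I K J (I Z.+ + 1) K J (λ { (q , i , k , j) → begin
  δ I (i ∸ 1) Q.* (δ K k Q.* (δ J j Q.* (ℕtoℚ i Q.* q)))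
    ≡⟨ solve 5 (λ a n b c q → a :* (b :* (c :* (n :* q))) := (a :* n) :* (b :* (c :* q))) refl
         (δ I (i ∸ 1)) (ℕtoℚ i) (δ K k) (δ J j) q ⟩
  (δ I (i ∸ 1) Q.* ℕtoℚ i) Q.* (δ K k Q.* (δ J j Q.* q))
    ≡⟨ cong (Q._* (δ K k Q.* (δ J j Q.* q))) (δ-pred-* I i) ⟩
  (ℤtoℚ (I Z.+ + 1) Q.* δ (I Z.+ + 1) i) Q.* (δ K k Q.* (δ J j Q.* q))
    ≡⟨ QP.*-assoc (ℤtoℚ (I Z.+ + 1)) (δ (I Z.+ + 1) i) (δ K k Q.* (δ J j Q.* q)) ⟩
  ℤtoℚ (I Z.+ + 1) Q.* (δ (I Z.+ + 1) i Q.* (δ K k Q.* (δ J j Q.* q))) ∎ }) p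

coeffℤ-∂b : ∀ p I K J → coeffℤ (∂b p) I K J ≡ ℤtoℚ (K Z.+ + 1) Q.* coeffℤ p I (K Z.+ + 1) J
coeffℤ-∂b p I K J = coeffℤ-map _ (ℤtoℚ (K Z.+ + 1)) I K J I (K Z.+ + 1) J (λ { (q , i , k , j) → begin
  δ I i Q.* (δ K (k ∸ 1) Q.* (δ J j Q.* (ℕtoℚ k Q.* q)))
    ≡⟨ solve 5 (λ a b n c q → a :* (b :* (c :* (n :* q))) := (b :* n) :* (a :* (c :* q))) refl
         (δ I i) (δ K (k ∸ 1)) (ℕtoℚ k) (δ J j) q ⟩
  (δ K (k ∸ 1) Q.* ℕtoℚ k) Q.* (δ I i Q.* (δ J j Q.* q))
    ≡⟨ cong (Q._* (δ I i Q.* (δ J j Q.* q))) (δ-pred-* K k) ⟩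
  (ℤtoℚ (K Z.+ + 1) Q.* δ (K Z.+ + 1) k) Q.* (δ I i Q.* (δ J j Q.* q))
    ≡⟨ solve 5 (λ e b a c q → (e :* b) :* (a :* (c :* q)) := e :* (a :* (b :* (c :* q)))) refl
         (ℤtoℚ (K Z.+ + 1)) (δ (K Z.+ + 1) k) (δ I i) (δ J j) q ⟩
  ℤtoℚ (K Z.+ + 1) Q.* (δ I i Q.* (δ (K Z.+ + 1) k Q.* (δ J j Q.* q))) ∎ }) p

coeffℤ-∂c : ∀ p I K J → coeffℤ (∂c p) I K J ≡ ℤtoℚ (J Z.+ + 1) Q.* coeffℤ p I K (J Z.+ + 1)
coeffℤ-∂c p I K J = coeffℤ-map _ (ℤtoℚ (J Z.+ + 1)) I K J I K (J Z.+ + 1) (λ { (q , i , k , j) → begin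
  δ I i Q.* (δ K k Q.* (δ J (j ∸ 1) Q.* (ℕtoℚ j Q.* q)))
    ≡⟨ solve 5 (λ a b c n q → a :* (b :* (c :* (n :* q))) := (c :* n) :* (a :* (b :* q))) refl
         (δ I i) (δ K k) (δ J (j ∸ 1)) (ℕtoℚ j) q ⟩
  (δ J (j ∸ 1) Q.* ℕtoℚ j) Q.* (δ I i Q.* (δ K k Q.* q))
    ≡⟨ cong (Q._* (δ I i Q.* (δ K k Q.* q))) (δ-pred-* J j) ⟩
  (ℤtoℚ (J Z.+ + 1) Q.* δ (J Z.+ + 1) j) Q.* (δ I i Q.* (δ K k Q.* q))
    ≡⟨ solve 5 (λ e c a b q → (e :* c) :* (a :* (b :* q)) := e :* (a :* (b :* (c :* q)))) refl
         (ℤtoℚ (J Z.+ + 1)) (δ (J Z.+ + 1) j) (δ I i) (δ K k) q ⟩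
  ℤtoℚ (J Z.+ + 1) Q.* (δ I i Q.* (δ K k Q.* (δ (J Z.+ + 1) j Q.* q))) ∎ }) p

coeffℤ-∂a-pred : ∀ p I K J → coeffℤ (∂a p) (I - + 1) K J ≡ ℤtoℚ I Q.* coeffℤ p I K J
coeffℤ-∂a-pred p I K J = trans (coeffℤ-∂a p (I - + 1) K J) (cong (λ I′ → ℤtoℚ I′ Q.* coeffℤ p I′ K J) (i-1+1≡i I))

coeffℤ-∂c-pred : ∀ p I K J → coeffℤ (∂c p) I K (J - + 1) ≡ ℤtoℚ J Q.* coeffℤ p I K J
coeffℤ-∂c-pred p I K J = trans (coeffℤ-∂c p I K (J - + 1)) (cong (λ J′ → ℤtoℚ J′ Q.* coeffℤ p I K J′) (i-1+1≡i J))

coeffℤ-vanishes : ∀ p I K J → I Z.< 0ℤ ⊎ K Z.< 0ℤ ⊎ J Z.< 0ℤ → coeffℤ p I K J ≡ 0ℚ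
coeffℤ-vanishes p -[1+ _ ] K J _ = refl
coeffℤ-vanishes p (+ _) -[1+ _ ] J _ = refl
coeffℤ-vanishes p (+ _) (+ _) -[1+ _ ] _ = refl
coeffℤ-vanishes p (+ _) (+ _) (+ _) (inj₁ (Z.+<+ ()))
coeffℤ-vanishes p (+ _) (+ _) (+ _) (inj₂ (inj₁ (Z.+<+ ())))
coeffℤ-vanishes p (+ _) (+ _) (+ _) (inj₂ (inj₂ (Z.+<+ ())))

coeffℤ-derivation : ∀ Pa Pb Pc p I K J → coeffℤ (derivation Pa Pb Pc p) I K J ≡
  coeffℤ (∂a p *P Pa) I K J Q.+ coeffℤ (∂c p *P Pc) I K J Q.+ coeffℤ (∂b p *P Pb) I K J
coeffℤ-derivation Pa Pb Pc p I K J = begin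
  coeffℤ (derivation Pa Pb Pc p) I K J             ≡⟨ coeffℤ-++ (∂a p *P Pa) _ I K J ⟩
  X Q.+ coeffℤ ((∂b p *P Pb) ++ (∂c p *P Pc)) I K J ≡⟨ cong (X Q.+_) (coeffℤ-++ (∂b p *P Pb) _ I K J) ⟩
  X Q.+ (Y Q.+ W)                                   ≡⟨ cong (X Q.+_) (QP.+-comm Y W) ⟩
  X Q.+ (W Q.+ Y)                                   ≡⟨ QP.+-assoc X W Y ⟨
  X Q.+ W Q.+ Y                                     ∎
  where
  X Y W : ℚ
  X = coeffℤ (∂a p *P Pa) I K J
  Y = coeffℤ (∂b p *P Pb) I K J
  W = coeffℤ (∂c p *P Pc) I K J

*-rotate : ∀ x y z → x Q.* y Q.* z ≡ z Q.* x Q.* y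
*-rotate x y z = solve 3 (λ x y z → x :* y :* z := z :* x :* y) refl x y z

coeffℤ-D3 : ∀ p I K J → coeffℤ (D3 p) I K J ≡
  ℤtoℚ (I Z.+ + 1) Q.* coeffℤ p (I Z.+ + 1) K (J - + 1)
  Q.+ ℤtoℚ J Q.* coeffℤ p I (K - + 1) J
  Q.+ (ℕtoℚ 2 Q.* ℤtoℚ (K Z.+ + 1)) Q.* coeffℤ p I (K Z.+ + 1) (J - + 1)
coeffℤ-D3 p I K J = trans (coeffℤ-derivation _ _ _ p I K J) (cong₂ Q._+_ (cong₂ Q._+_ a-part c-part) b-part)
  where
  a-part : coeffℤ (∂a p *P var-c) I K J ≡ ℤtoℚ (I Z.+ + 1) Q.* coeffℤ p (I Z.+ + 1) K (J - + 1)
  a-part = trans (coeffℤ-*-monomial (∂a p) _ 0 0 1 I K J) (trans (QP.*-identityʳ _) (coeffℤ-∂a p I K (J - + 1)))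
  c-part : coeffℤ (∂c p *P (var-b *P var-c)) I K J ≡ ℤtoℚ J Q.* coeffℤ p I (K - + 1) J
  c-part = trans (coeffℤ-*-monomial (∂c p) _ 0 1 1 I K J) (trans (QP.*-identityʳ _) (coeffℤ-∂c-pred p I (K - + 1) J))
  b-part : coeffℤ (∂b p *P scaleP (ℕtoℚ 2) var-c) I K J ≡ (ℕtoℚ 2 Q.* ℤtoℚ (K Z.+ + 1)) Q.* coeffℤ p I (K Z.+ + 1) (J - + 1)
  b-part = trans (coeffℤ-*-monomial (∂b p) _ 0 0 1 I K J) (trans (cong (Q._* ℕtoℚ 2) (coeffℤ-∂b p I K (J - + 1)))
    (*-rotate (ℤtoℚ (K Z.+ + 1)) (coeffℤ p I (K Z.+ + 1) (J - + 1)) (ℕtoℚ 2)))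

coeffℤ-D4 : ∀ p I K J → coeffℤ (D4 p) I K J ≡
  ℤtoℚ I Q.* coeffℤ p I K (J - + 1)
  Q.+ ℤtoℚ J Q.* coeffℤ p (I - + 1) (K - + 1) J
  Q.+ (ℕtoℚ 2 Q.* ℤtoℚ (K Z.+ + 1)) Q.* coeffℤ p (I - + 1) (K Z.+ + 1) (J - + 1)
coeffℤ-D4 p I K J = trans (coeffℤ-derivation _ _ _ p I K J) (cong₂ Q._+_ (cong₂ Q._+_ a-part c-part) b-part)
  where
  a-part : coeffℤ (∂a p *P (var-a *P var-c)) I K J ≡ ℤtoℚ I Q.* coeffℤ p I K (J - + 1)
  a-part = trans (coeffℤ-*-monomial (∂a p) _ 1 0 1 I K J) (trans (QP.*-identityʳ _) (coeffℤ-∂a-pred p I K (J - + 1)))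
  c-part : coeffℤ (∂c p *P ((var-a *P var-b) *P var-c)) I K J ≡ ℤtoℚ J Q.* coeffℤ p (I - + 1) (K - + 1) J
  c-part = trans (coeffℤ-*-monomial (∂c p) _ 1 1 1 I K J) (trans (QP.*-identityʳ _) (coeffℤ-∂c-pred p (I - + 1) (K - + 1) J))
  b-part : coeffℤ (∂b p *P scaleP (ℕtoℚ 2) (var-a *P var-c)) I K J ≡
           (ℕtoℚ 2 Q.* ℤtoℚ (K Z.+ + 1)) Q.* coeffℤ p (I - + 1) (K Z.+ + 1) (J - + 1)
  b-part = trans (coeffℤ-*-monomial (∂b p) _ 1 0 1 I K J) (trans (cong (Q._* ℕtoℚ 2) (coeffℤ-∂b p (I - + 1) K (J - + 1)))
    (*-rotate (ℤtoℚ (K Z.+ + 1)) (coeffℤ p (I - + 1) (K Z.+ + 1) (J - + 1)) (ℕtoℚ 2)))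


-- Weighted slices

-- The coefficient of a^i b^(d-i-2j) c^j, i.e. of the weight-d component.
slice : Poly → ℤ → ℤ → ℤ → ℚ
slice p d i j = coeffℤ p i (d - i - + 2 Z.* j) j

slice-D4 : ∀ p {e d c} → d ≡ e Z.+ + 2 → c ≡ e Z.+ + 3 → ∀ i j → slice (D4 p) d i j ≡
  ℤtoℚ i Q.* slice p e i (j - + 1) Q.+ ℤtoℚ j Q.* slice p e (i - + 1) j
  Q.+ ℤtoℚ (+ 2 Z.* (c - i - + 2 Z.* j)) Q.* slice p e (i - + 1) (j - + 1)
slice-D4 p {e} refl refl i j = trans (coeffℤ-D4 p i K j) (cong₂ Q._+_
  (cong₂ Q._+_ (cong (λ k → ℤtoℚ i Q.* coeffℤ p i k (j - + 1)) (b-exp₁ e i j))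
               (cong (λ k → ℤtoℚ j Q.* coeffℤ p (i - + 1) k j) (b-exp₂ e i j)))
  (cong₂ (λ x k → x Q.* coeffℤ p (i - + 1) k (j - + 1))
         (trans (twice-ℤtoℚ (K Z.+ + 1)) (cong (λ k → ℤtoℚ (+ 2 Z.* k)) (factor e i j)))
         (b-exp₃ e i j)))
  where
  K : ℤ
  K = e Z.+ + 2 - i - + 2 Z.* j
  b-exp₁ : ∀ e i j → e Z.+ + 2 - i - + 2 Z.* j ≡ e - i - + 2 Z.* (j - + 1)
  b-exp₁ = solve-∀
  b-exp₂ : ∀ e i j → e Z.+ + 2 - i - + 2 Z.* j - + 1 ≡ e - (i - + 1) - + 2 Z.* j
  b-exp₂ = solve-∀
  b-exp₃ : ∀ e i j → e Z.+ + 2 - i - + 2 Z.* j Z.+ + 1 ≡ e - (i - + 1) - + 2 Z.* (j - + 1)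
  b-exp₃ = solve-∀
  factor : ∀ e i j → e Z.+ + 2 - i - + 2 Z.* j Z.+ + 1 ≡ e Z.+ + 3 - i - + 2 Z.* j
  factor = solve-∀

slice-D3 : ∀ p {e d c} → d ≡ e Z.+ + 1 → c ≡ e Z.+ + 2 → ∀ i j → slice (D3 p) d i j ≡
  ℤtoℚ (i Z.+ + 1) Q.* slice p e (i Z.+ + 1) (j - + 1) Q.+ ℤtoℚ j Q.* slice p e i j
  Q.+ ℤtoℚ (+ 2 Z.* (c - i - + 2 Z.* j)) Q.* slice p e i (j - + 1)
slice-D3 p {e} refl refl i j = trans (coeffℤ-D3 p i K j) (cong₂ Q._+_
  (cong₂ Q._+_ (cong (λ k → ℤtoℚ (i Z.+ + 1) Q.* coeffℤ p (i Z.+ + 1) k (j - + 1)) (b-exp₁ e i j))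
               (cong (λ k → ℤtoℚ j Q.* coeffℤ p i k j) (b-exp₂ e i j)))
  (cong₂ (λ x k → x Q.* coeffℤ p i k (j - + 1))
         (trans (twice-ℤtoℚ (K Z.+ + 1)) (cong (λ k → ℤtoℚ (+ 2 Z.* k)) (factor e i j)))
         (b-exp₃ e i j)))
  where
  K : ℤ
  K = e Z.+ + 1 - i - + 2 Z.* j
  b-exp₁ : ∀ e i j → e Z.+ + 1 - i - + 2 Z.* j ≡ e - (i Z.+ + 1) - + 2 Z.* (j - + 1)
  b-exp₁ = solve-∀
  b-exp₂ : ∀ e i j → e Z.+ + 1 - i - + 2 Z.* j - + 1 ≡ e - i - + 2 Z.* j
  b-exp₂ = solve-∀
  b-exp₃ : ∀ e i j → e Z.+ + 1 - i - + 2 Z.* j Z.+ + 1 ≡ e - i - + 2 Z.* (j - + 1)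
  b-exp₃ = solve-∀
  factor : ∀ e i j → e Z.+ + 1 - i - + 2 Z.* j Z.+ + 1 ≡ e Z.+ + 2 - i - + 2 Z.* j
  factor = solve-∀

s-recurrence : (n : ℕ) → n ≥ 1 → (i j : ℤ) →
  s n i j ≡ (ℤtoℚ i Q.* t n i (j - + 1)) Q.+ (ℤtoℚ j Q.* t n (i - + 1) j)
            Q.+ (ℤtoℚ (+ 2 Z.* (+ (3 * n + 2) - i - + 2 Z.* j)) Q.* t n (i - + 1) (j - + 1))
s-recurrence (suc m) _ = slice-D4 (D3 (D43^ m var-a)) {+ (3 * suc m) - + 1} (degree 1 2 solve-∀) (degree 2 3 solve-∀)
  where
  degree : ∀ k l → (∀ y → y Z.+ + k ≡ y - + 1 Z.+ + l) → + (3 * suc m + k) ≡ + (3 * suc m) - + 1 Z.+ + l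
  degree k l eq = trans (ZP.pos-+ (3 * suc m) k) (eq (+ (3 * suc m)))

t-recurrence : (n : ℕ) → (i j : ℤ) →
  t (suc n) i j ≡ (ℤtoℚ (i Z.+ + 1) Q.* s n (i Z.+ + 1) (j - + 1)) Q.+ (ℤtoℚ j Q.* s n i j)
                  Q.+ (ℤtoℚ (+ 2 Z.* (+ (3 * n + 3) - i - + 2 Z.* j)) Q.* s n i (j - + 1))
t-recurrence n = slice-D3 (D43^ n var-a) {+ (3 * n + 1)} degree codegree
  where
  y : ℤ
  y = + (3 * n)
  degree : + (3 * suc n) - + 1 ≡ + (3 * n + 1) Z.+ + 1
  degree = begin
    + (3 * suc n) - + 1    ≡⟨ cong (λ x → + x - + 1) (NP.*-suc 3 n) ⟩
    + (3 + 3 * n) - + 1    ≡⟨ cong (_- + 1) (ZP.pos-+ 3 (3 * n)) ⟩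
    + 3 Z.+ y - + 1        ≡⟨ lemma y ⟩
    y Z.+ + 1 Z.+ + 1      ≡⟨ cong (Z._+ + 1) (ZP.pos-+ (3 * n) 1) ⟨
    + (3 * n + 1) Z.+ + 1  ∎
    where
    lemma : ∀ y → + 3 Z.+ y - + 1 ≡ y Z.+ + 1 Z.+ + 1
    lemma = solve-∀
  codegree : + (3 * n + 3) ≡ + (3 * n + 1) Z.+ + 2
  codegree = begin
    + (3 * n + 3)          ≡⟨ ZP.pos-+ (3 * n) 3 ⟩
    y Z.+ + 3              ≡⟨ lemma y ⟩
    y Z.+ + 1 Z.+ + 2      ≡⟨ cong (Z._+ + 2) (ZP.pos-+ (3 * n) 1) ⟨
    + (3 * n + 1) Z.+ + 2  ∎
    where
    lemma : ∀ y → y Z.+ + 3 ≡ y Z.+ + 1 Z.+ + 2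
    lemma = solve-∀

coeff-D3-var-a : ∀ i k j → ¬ (i ≡ 0 × k ≡ 0 × j ≡ 1) → coeff (D3 var-a) i k j ≡ 0ℚ
coeff-D3-var-a 0 0 1 off = ⊥-elim (off (refl , refl , refl))
coeff-D3-var-a 0 0 0 _ = refl
coeff-D3-var-a 0 0 (suc (suc _)) _ = refl
coeff-D3-var-a 0 (suc _) _ _ = refl
coeff-D3-var-a 1 0 0 _ = refl
coeff-D3-var-a 1 0 1 _ = refl
coeff-D3-var-a 1 0 (suc (suc _)) _ = refl
coeff-D3-var-a 1 1 0 _ = refl
coeff-D3-var-a 1 1 1 _ = refl
coeff-D3-var-a 1 1 (suc (suc _)) _ = refl
coeff-D3-var-a 1 (suc (suc _)) _ _ = refl
coeff-D3-var-a (suc (suc _)) _ _ _ = refl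

t₁-vanishes : (i j : ℤ) → ¬ (i ≡ + 0 × j ≡ + 1) → t 1 i j ≡ 0ℚ
t₁-vanishes i j off = vanishes i (+ 3 - + 1 - i - + 2 Z.* j) j (λ (i≡0 , _ , j≡1) → off (i≡0 , j≡1))
  where
  vanishes : ∀ I K J → ¬ (I ≡ + 0 × K ≡ + 0 × J ≡ + 1) → coeffℤ (D3 var-a) I K J ≡ 0ℚ
  vanishes (+ i) (+ k) (+ j) off = coeff-D3-var-a i k j (λ { (refl , refl , refl) → off (refl , refl , refl) })
  vanishes (+ _) (+ _) -[1+ _ ] _ = refl
  vanishes (+ _) -[1+ _ ] _ _ = refl
  vanishes -[1+ _ ] _ _ _ = refl

slice-vanishes⁻ : ∀ p d I J → I Z.< 0ℤ ⊎ J Z.< 0ℤ → slice p d I J ≡ 0ℚ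
slice-vanishes⁻ p d I J (inj₁ I<0) = coeffℤ-vanishes p I _ J (inj₁ I<0)
slice-vanishes⁻ p d I J (inj₂ J<0) = coeffℤ-vanishes p I _ J (inj₂ (inj₂ J<0))

x<y⇒x-y<0 : ∀ {x y} → x Z.< y → x - y Z.< 0ℤ
x<y⇒x-y<0 {x} {y} x<y = subst (x - y Z.<_) (ZP.+-inverseʳ y) (ZP.+-monoˡ-< (Z.- y) x<y)

slice-vanishes⁺ : ∀ p d N → d Z.≤ + N → ∀ a b → N < a ⊎ N < b → slice p d (+ a) (+ b) ≡ 0ℚ
slice-vanishes⁺ p d N d≤N a b outside = coeffℤ-vanishes p (+ a) _ (+ b) (inj₂ (inj₁ negative-b-exponent))
  where
  N<a+2b : N < a ⊎ N < b → N < a + 2 * b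
  N<a+2b (inj₁ N<a) = NP.<-≤-trans N<a (NP.m≤m+n a (2 * b))
  N<a+2b (inj₂ N<b) = NP.<-≤-trans N<b (NP.≤-trans (NP.m≤m+n b (b + 0)) (NP.m≤n+m (2 * b) a))
  a+2b : + (a + 2 * b) ≡ + a Z.+ + 2 Z.* + b
  a+2b = trans (ZP.pos-+ a (2 * b)) (cong (λ x → + a Z.+ x) (ZP.pos-* 2 b))
  negative-b-exponent : d - + a - + 2 Z.* + b Z.< 0ℤ
  negative-b-exponent = subst (Z._< 0ℤ) (trans (cong (d -_) a+2b) (regroup d (+ a) (+ 2 Z.* + b)))
    (x<y⇒x-y<0 (ZP.≤-<-trans d≤N (Z.+<+ (N<a+2b outside))))
    where
    regroup : ∀ d x y → d - (x Z.+ y) ≡ d - x - y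
    regroup = solve-∀


-- Coefficients in ℚ[x,y]

coeff2ℤ : Poly2 → ℤ → ℤ → ℚ
coeff2ℤ p (+ a) (+ b) = coeff2 p a b
coeff2ℤ p _ _ = 0ℚ

termCoeff2 : ℤ → ℤ → ℚ × ℕ × ℕ → ℚ
termCoeff2 I J (q , i , j) = δ I i Q.* (δ J j Q.* q)

coeff2ℤ-∑ : ∀ p I J → coeff2ℤ p I J ≡ ∑ (termCoeff2 I J) p
coeff2ℤ-∑ [] (+ _) (+ _) = refl
coeff2ℤ-∑ ((q , i′ , j′) ∷ p) (+ i) (+ j) = cong₂ Q._+_ selector (coeff2ℤ-∑ p (+ i) (+ j))
  where
  selector : (if ⌊ i N.≟ i′ ⌋ ∧ ⌊ j N.≟ j′ ⌋ then q else 0ℚ) ≡ termCoeff2 (+ i) (+ j) (q , i′ , j′)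
  selector = trans (if-∧-then-0 ⌊ i N.≟ i′ ⌋ _ q) (cong (δ (+ i) i′ Q.*_) (if-then-0 ⌊ j N.≟ j′ ⌋ q))
coeff2ℤ-∑ p -[1+ _ ] J = sym (∑-zero (λ { (q , i , j) → QP.*-zeroˡ (δ J j Q.* q) }) p)
coeff2ℤ-∑ p (+ i) -[1+ _ ] = sym (∑-zero (λ { (q , i′ , j) → *-≡0ʳ (δ (+ i) i′) (QP.*-zeroˡ q) }) p)

coeff2ℤ-++ : ∀ p p′ I J → coeff2ℤ (p ++ p′) I J ≡ coeff2ℤ p I J Q.+ coeff2ℤ p′ I J
coeff2ℤ-++ p p′ I J = begin
  coeff2ℤ (p ++ p′) I J                             ≡⟨ coeff2ℤ-∑ (p ++ p′) I J ⟩
  ∑ (termCoeff2 I J) (p ++ p′)                      ≡⟨ ∑-++ (termCoeff2 I J) p p′ ⟩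
  ∑ (termCoeff2 I J) p Q.+ ∑ (termCoeff2 I J) p′    ≡⟨ cong₂ Q._+_ (coeff2ℤ-∑ p I J) (coeff2ℤ-∑ p′ I J) ⟨
  coeff2ℤ p I J Q.+ coeff2ℤ p′ I J                  ∎

coeff2ℤ-map : ∀ (g : ℚ × ℕ × ℕ → ℚ × ℕ × ℕ) c I J I′ J′ →
  (∀ x → termCoeff2 I J (g x) ≡ c Q.* termCoeff2 I′ J′ x) →
  ∀ p → coeff2ℤ (map g p) I J ≡ c Q.* coeff2ℤ p I′ J′
coeff2ℤ-map g c I J I′ J′ scaled p = begin
  coeff2ℤ (map g p) I J                   ≡⟨ coeff2ℤ-∑ (map g p) I J ⟩
  ∑ (termCoeff2 I J) (map g p)            ≡⟨ ∑-map (termCoeff2 I J) g p ⟩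
  ∑ (λ x → termCoeff2 I J (g x)) p        ≡⟨ ∑-cong scaled p ⟩
  ∑ (λ x → c Q.* termCoeff2 I′ J′ x) p    ≡⟨ ∑-*ˡ c (termCoeff2 I′ J′) p ⟩
  c Q.* ∑ (termCoeff2 I′ J′) p            ≡⟨ cong (c Q.*_) (coeff2ℤ-∑ p I′ J′) ⟨
  c Q.* coeff2ℤ p I′ J′                   ∎

coeff2ℤ-*ˡ : ∀ L P I J → coeff2ℤ (L *P2 P) I J ≡ ∑ (λ { (r , u , v) → r Q.* coeff2ℤ P (I ↓ u) (J ↓ v) }) L
coeff2ℤ-*ˡ [] P I J = coeff2ℤ-∑ [] I J
coeff2ℤ-*ˡ ((r , u , v) ∷ L) P I J = trans (coeff2ℤ-++ (map _ P) (L *P2 P) I J)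
  (cong₂ Q._+_ (coeff2ℤ-map _ r I J (I ↓ u) (J ↓ v) (λ { (q , i , j) → shift q i j }) P) (coeff2ℤ-*ˡ L P I J))
  where
  shift : ∀ q i j → δ I (u + i) Q.* (δ J (v + j) Q.* (r Q.* q)) ≡ r Q.* (δ (I ↓ u) i Q.* (δ (J ↓ v) j Q.* q))
  shift q i j = trans (cong₂ (λ a b → a Q.* (b Q.* (r Q.* q))) (δ-+ I u i) (δ-+ J v j))
    (solve 4 (λ a b r q → a :* (b :* (r :* q)) := r :* (a :* (b :* q))) refl (δ (I ↓ u) i) (δ (J ↓ v) j) r q)

coeff2ℤ-∂x : ∀ P I J → coeff2ℤ (∂x P) I J ≡ ℤtoℚ (I Z.+ + 1) Q.* coeff2ℤ P (I Z.+ + 1) J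
coeff2ℤ-∂x P I J = coeff2ℤ-map _ (ℤtoℚ (I Z.+ + 1)) I J (I Z.+ + 1) J (λ { (q , i , j) → begin
  δ I (i ∸ 1) Q.* (δ J j Q.* (ℕtoℚ i Q.* q))
    ≡⟨ solve 4 (λ a b n q → a :* (b :* (n :* q)) := (a :* n) :* (b :* q)) refl (δ I (i ∸ 1)) (δ J j) (ℕtoℚ i) q ⟩
  (δ I (i ∸ 1) Q.* ℕtoℚ i) Q.* (δ J j Q.* q)
    ≡⟨ cong (Q._* (δ J j Q.* q)) (δ-pred-* I i) ⟩
  (ℤtoℚ (I Z.+ + 1) Q.* δ (I Z.+ + 1) i) Q.* (δ J j Q.* q)
    ≡⟨ QP.*-assoc (ℤtoℚ (I Z.+ + 1)) (δ (I Z.+ + 1) i) (δ J j Q.* q) ⟩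
  ℤtoℚ (I Z.+ + 1) Q.* (δ (I Z.+ + 1) i Q.* (δ J j Q.* q)) ∎ }) P

coeff2ℤ-∂y : ∀ P I J → coeff2ℤ (∂y P) I J ≡ ℤtoℚ (J Z.+ + 1) Q.* coeff2ℤ P I (J Z.+ + 1)
coeff2ℤ-∂y P I J = coeff2ℤ-map _ (ℤtoℚ (J Z.+ + 1)) I J I (J Z.+ + 1) (λ { (q , i , j) → begin
  δ I i Q.* (δ J (j ∸ 1) Q.* (ℕtoℚ j Q.* q))
    ≡⟨ solve 4 (λ a b n q → a :* (b :* (n :* q)) := (b :* n) :* (a :* q)) refl (δ I i) (δ J (j ∸ 1)) (ℕtoℚ j) q ⟩
  (δ J (j ∸ 1) Q.* ℕtoℚ j) Q.* (δ I i Q.* q)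
    ≡⟨ cong (Q._* (δ I i Q.* q)) (δ-pred-* J j) ⟩
  (ℤtoℚ (J Z.+ + 1) Q.* δ (J Z.+ + 1) j) Q.* (δ I i Q.* q)
    ≡⟨ solve 4 (λ e b a q → (e :* b) :* (a :* q) := e :* (a :* (b :* q))) refl (ℤtoℚ (J Z.+ + 1)) (δ (J Z.+ + 1) j) (δ I i) q ⟩
  ℤtoℚ (J Z.+ + 1) Q.* (δ I i Q.* (δ (J Z.+ + 1) j Q.* q)) ∎ }) P

coeff2ℤ-∂x-pred : ∀ P I J → coeff2ℤ (∂x P) (I - + 1) J ≡ ℤtoℚ I Q.* coeff2ℤ P I J
coeff2ℤ-∂x-pred P I J = trans (coeff2ℤ-∂x P (I - + 1) J) (cong (λ I′ → ℤtoℚ I′ Q.* coeff2ℤ P I′ J) (i-1+1≡i I))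

coeff2ℤ-∂y-pred : ∀ P I J → coeff2ℤ (∂y P) I (J - + 1) ≡ ℤtoℚ J Q.* coeff2ℤ P I J
coeff2ℤ-∂y-pred P I J = trans (coeff2ℤ-∂y P I (J - + 1)) (cong (λ J′ → ℤtoℚ J′ Q.* coeff2ℤ P I J′) (i-1+1≡i J))

coeff2-genPoly : ∀ N (f : ℤ → ℤ → ℚ) → (∀ a b → N < a ⊎ N < b → f (+ a) (+ b) ≡ 0ℚ) →
  ∀ a b → coeff2 (genPoly N f) a b ≡ f (+ a) (+ b)
coeff2-genPoly N f vanish a b = begin
  coeff2 (genPoly N f) a b                                   ≡⟨ coeff2ℤ-∑ (genPoly N f) (+ a) (+ b) ⟩
  ∑ (termCoeff2 (+ a) (+ b)) (concatMap row box)             ≡⟨ ∑-concatMap (termCoeff2 (+ a) (+ b)) row box ⟩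
  ∑ (λ i → ∑ (termCoeff2 (+ a) (+ b)) (row i)) box           ≡⟨ ∑-cong row-sum box ⟩
  ∑ (λ i → δ (+ a) i Q.* column i) box                       ≡⟨ ∑-δ-upTo (suc N) a column column-vanishes ⟩
  column a                                                   ≡⟨ column-sum a ⟩
  f (+ a) (+ b)                                              ∎
  where
  box : List ℕ
  box = upTo (suc N)
  row : ℕ → Poly2
  row i = map (λ j → (f (+ i) (+ j) , i , j)) box
  column : ℕ → ℚ
  column i = ∑ (λ j → δ (+ b) j Q.* f (+ i) (+ j)) box
  row-sum : ∀ i → ∑ (termCoeff2 (+ a) (+ b)) (row i) ≡ δ (+ a) i Q.* column i
  row-sum i = trans (∑-map (termCoeff2 (+ a) (+ b)) _ box) (∑-*ˡ (δ (+ a) i) (λ j → δ (+ b) j Q.* f (+ i) (+ j)) box)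
  column-sum : ∀ i → column i ≡ f (+ i) (+ b)
  column-sum i = ∑-δ-upTo (suc N) b (λ j → f (+ i) (+ j)) (λ N<b → vanish i b (inj₂ N<b))
  column-vanishes : N < a → column a ≡ 0ℚ
  column-vanishes N<a = trans (column-sum a) (vanish a b (inj₁ N<a))

coeff2ℤ-genPoly : ∀ N (f : ℤ → ℤ → ℚ) → (∀ a b → N < a ⊎ N < b → f (+ a) (+ b) ≡ 0ℚ) →
  (∀ I J → I Z.< 0ℤ ⊎ J Z.< 0ℤ → f I J ≡ 0ℚ) → ∀ I J → coeff2ℤ (genPoly N f) I J ≡ f I J
coeff2ℤ-genPoly N f vanish _ (+ a) (+ b) = coeff2-genPoly N f vanish a b
coeff2ℤ-genPoly N f _ vanish⁻ -[1+ m ] J = sym (vanish⁻ -[1+ m ] J (inj₁ Z.-<+))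
coeff2ℤ-genPoly N f _ vanish⁻ (+ a) -[1+ m ] = sym (vanish⁻ (+ a) -[1+ m ] (inj₂ Z.-<+))

coeff2ℤ-sPoly : ∀ n I J → coeff2ℤ (sPoly n) I J ≡ s n I J
coeff2ℤ-sPoly n = coeff2ℤ-genPoly (3 * n + 1) (s n)
  (slice-vanishes⁺ (D43^ n var-a) (+ (3 * n + 1)) _ ZP.≤-refl) (slice-vanishes⁻ (D43^ n var-a) (+ (3 * n + 1)))

coeff2ℤ-tPoly : ∀ n I J → coeff2ℤ (tPoly n) I J ≡ t n I J
coeff2ℤ-tPoly n = coeff2ℤ-genPoly (3 * n + 1) (t n)
  (slice-vanishes⁺ (D3 (D43^ (n ∸ 1) var-a)) d _ (ZP.≤-trans (ZP.i-j≤i (+ (3 * n)) (+ 1)) (Z.+≤+ (NP.m≤m+n (3 * n) 1))))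
  (slice-vanishes⁻ (D3 (D43^ (n ∸ 1) var-a)) d)
  where
  d : ℤ
  d = + (3 * n) - + 1


-- Generating polynomials

xyOperator yOperator : ℤ → Poly2 → Poly2
xyOperator γ T = ((((const2 (ℤtoℚ γ) *P2 var-x) *P2 var-y) *P2 T)
                 +P2 (((var-x *P2 var-y) *P2 (const2 1ℚ +P2 const2 (Q.- ℕtoℚ 2) *P2 var-x)) *P2 ∂x T)
                 +P2 (((var-x *P2 var-y) *P2 (const2 1ℚ +P2 const2 (Q.- ℕtoℚ 4) *P2 var-y)) *P2 ∂y T))
yOperator γ S = (((const2 (ℤtoℚ γ) *P2 var-y) *P2 S)
                +P2 ((var-y *P2 (const2 1ℚ +P2 const2 (Q.- ℕtoℚ 2) *P2 var-x)) *P2 ∂x S)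
                +P2 ((var-y *P2 (const2 1ℚ +P2 const2 (Q.- ℕtoℚ 4) *P2 var-y)) *P2 ∂y S))

coeff2ℤ-+P2₃ : ∀ A B C I J → coeff2ℤ (A +P2 B +P2 C) I J ≡ coeff2ℤ A I J Q.+ coeff2ℤ B I J Q.+ coeff2ℤ C I J
coeff2ℤ-+P2₃ A B C I J = trans (coeff2ℤ-++ (A ++ B) C I J) (cong (Q._+ coeff2ℤ C I J) (coeff2ℤ-++ A B I J))

sum-of-two-terms : ∀ m u v → 1ℚ Q.* u Q.+ (m Q.* v Q.+ 0ℚ) ≡ u Q.+ m Q.* v
sum-of-two-terms m u v = cong₂ Q._+_ (QP.*-identityˡ u) (QP.+-identityʳ (m Q.* v))

collect-terms : ∀ g W a A b B M N →
  g Q.* W Q.+ (a Q.* A Q.+ Q.- ℕtoℚ 2 Q.* (M Q.* W)) Q.+ (b Q.* B Q.+ Q.- ℕtoℚ 4 Q.* (N Q.* W))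
  ≡ a Q.* A Q.+ b Q.* B Q.+ (g Q.+ Q.- ℕtoℚ 2 Q.* M Q.+ Q.- ℕtoℚ 4 Q.* N) Q.* W
collect-terms g W a A b B M N =
  solve 10 (λ g W a A b B M N m₂ m₄ →
      g :* W :+ (a :* A :+ m₂ :* (M :* W)) :+ (b :* B :+ m₄ :* (N :* W))
      := a :* A :+ b :* B :+ (g :+ m₂ :* M :+ m₄ :* N) :* W)
    refl g W a A b B M N (Q.- ℕtoℚ 2) (Q.- ℕtoℚ 4)

coeff2ℤ-xyOperator : ∀ γ T (f : ℤ → ℤ → ℚ) → (∀ I J → coeff2ℤ T I J ≡ f I J) → ∀ I J →
  coeff2ℤ (xyOperator γ T) I J ≡ ℤtoℚ I Q.* f I (J - + 1) Q.+ ℤtoℚ J Q.* f (I - + 1) J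
    Q.+ ℤtoℚ (γ - + 2 Z.* (I - + 1) - + 4 Z.* (J - + 1)) Q.* f (I - + 1) (J - + 1)
coeff2ℤ-xyOperator γ T f T≡f I J = begin
  coeff2ℤ (xyOperator γ T) I J
    ≡⟨ coeff2ℤ-+P2₃ (Lγ *P2 T) (Lx *P2 ∂x T) (Ly *P2 ∂y T) I J ⟩
  coeff2ℤ (Lγ *P2 T) I J Q.+ coeff2ℤ (Lx *P2 ∂x T) I J Q.+ coeff2ℤ (Ly *P2 ∂y T) I J
    ≡⟨ cong₂ Q._+_ (cong₂ Q._+_ constant-part x-part) y-part ⟩
  ℤtoℚ γ Q.* f₁₁ Q.+ (ℤtoℚ I Q.* f₀₁ Q.+ Q.- ℕtoℚ 2 Q.* (ℤtoℚ (I - + 1) Q.* f₁₁))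
    Q.+ (ℤtoℚ J Q.* f₁₀ Q.+ Q.- ℕtoℚ 4 Q.* (ℤtoℚ (J - + 1) Q.* f₁₁))
    ≡⟨ collect-terms (ℤtoℚ γ) f₁₁ (ℤtoℚ I) f₀₁ (ℤtoℚ J) f₁₀ (ℤtoℚ (I - + 1)) (ℤtoℚ (J - + 1)) ⟩
  ℤtoℚ I Q.* f₀₁ Q.+ ℤtoℚ J Q.* f₁₀
    Q.+ (ℤtoℚ γ Q.+ Q.- ℕtoℚ 2 Q.* ℤtoℚ (I - + 1) Q.+ Q.- ℕtoℚ 4 Q.* ℤtoℚ (J - + 1)) Q.* f₁₁
    ≡⟨ cong (λ x → ℤtoℚ I Q.* f₀₁ Q.+ ℤtoℚ J Q.* f₁₀ Q.+ x Q.* f₁₁) (ℤtoℚ-linear γ (I - + 1) (J - + 1)) ⟩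
  ℤtoℚ I Q.* f₀₁ Q.+ ℤtoℚ J Q.* f₁₀ Q.+ ℤtoℚ (γ - + 2 Z.* (I - + 1) - + 4 Z.* (J - + 1)) Q.* f₁₁ ∎
  where
  f₀₁ f₁₀ f₁₁ : ℚ
  f₀₁ = f I (J - + 1)
  f₁₀ = f (I - + 1) J
  f₁₁ = f (I - + 1) (J - + 1)
  Lγ Lx Ly : Poly2
  Lγ = (const2 (ℤtoℚ γ) *P2 var-x) *P2 var-y
  Lx = (var-x *P2 var-y) *P2 (const2 1ℚ +P2 const2 (Q.- ℕtoℚ 2) *P2 var-x)
  Ly = (var-x *P2 var-y) *P2 (const2 1ℚ +P2 const2 (Q.- ℕtoℚ 4) *P2 var-y)
  constant-part : coeff2ℤ (Lγ *P2 T) I J ≡ ℤtoℚ γ Q.* f₁₁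
  constant-part = trans (coeff2ℤ-*ˡ Lγ T I J)
    (trans (QP.+-identityʳ _) (cong₂ Q._*_ (trans (QP.*-identityʳ _) (QP.*-identityʳ (ℤtoℚ γ))) (T≡f (I - + 1) (J - + 1))))
  x-part : coeff2ℤ (Lx *P2 ∂x T) I J ≡ ℤtoℚ I Q.* f₀₁ Q.+ Q.- ℕtoℚ 2 Q.* (ℤtoℚ (I - + 1) Q.* f₁₁)
  x-part = trans (coeff2ℤ-*ˡ Lx (∂x T) I J)
    (trans (sum-of-two-terms (Q.- ℕtoℚ 2) (coeff2ℤ (∂x T) (I - + 1) (J - + 1)) (coeff2ℤ (∂x T) (I - + 1 - + 1) (J - + 1)))
    (cong₂ (λ u v → u Q.+ Q.- ℕtoℚ 2 Q.* v)
      (trans (coeff2ℤ-∂x-pred T I (J - + 1)) (cong (ℤtoℚ I Q.*_) (T≡f I (J - + 1))))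
      (trans (coeff2ℤ-∂x-pred T (I - + 1) (J - + 1)) (cong (ℤtoℚ (I - + 1) Q.*_) (T≡f (I - + 1) (J - + 1))))))
  y-part : coeff2ℤ (Ly *P2 ∂y T) I J ≡ ℤtoℚ J Q.* f₁₀ Q.+ Q.- ℕtoℚ 4 Q.* (ℤtoℚ (J - + 1) Q.* f₁₁)
  y-part = trans (coeff2ℤ-*ˡ Ly (∂y T) I J)
    (trans (sum-of-two-terms (Q.- ℕtoℚ 4) (coeff2ℤ (∂y T) (I - + 1) (J - + 1)) (coeff2ℤ (∂y T) (I - + 1) (J - + 1 - + 1)))
    (cong₂ (λ u v → u Q.+ Q.- ℕtoℚ 4 Q.* v)
      (trans (coeff2ℤ-∂y-pred T (I - + 1) J) (cong (ℤtoℚ J Q.*_) (T≡f (I - + 1) J)))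
      (trans (coeff2ℤ-∂y-pred T (I - + 1) (J - + 1)) (cong (ℤtoℚ (J - + 1) Q.*_) (T≡f (I - + 1) (J - + 1))))))

coeff2ℤ-yOperator : ∀ γ S (f : ℤ → ℤ → ℚ) → (∀ I J → coeff2ℤ S I J ≡ f I J) → ∀ I J →
  coeff2ℤ (yOperator γ S) I J ≡ ℤtoℚ (I Z.+ + 1) Q.* f (I Z.+ + 1) (J - + 1) Q.+ ℤtoℚ J Q.* f I J
    Q.+ ℤtoℚ (γ - + 2 Z.* I - + 4 Z.* (J - + 1)) Q.* f I (J - + 1)
coeff2ℤ-yOperator γ S f S≡f I J = begin
  coeff2ℤ (yOperator γ S) I J
    ≡⟨ coeff2ℤ-+P2₃ (Lγ *P2 S) (Lx *P2 ∂x S) (Ly *P2 ∂y S) I J ⟩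
  coeff2ℤ (Lγ *P2 S) I J Q.+ coeff2ℤ (Lx *P2 ∂x S) I J Q.+ coeff2ℤ (Ly *P2 ∂y S) I J
    ≡⟨ cong₂ Q._+_ (cong₂ Q._+_ constant-part x-part) y-part ⟩
  ℤtoℚ γ Q.* f₀₁ Q.+ (ℤtoℚ (I Z.+ + 1) Q.* f₋₁ Q.+ Q.- ℕtoℚ 2 Q.* (ℤtoℚ I Q.* f₀₁))
    Q.+ (ℤtoℚ J Q.* f₀₀ Q.+ Q.- ℕtoℚ 4 Q.* (ℤtoℚ (J - + 1) Q.* f₀₁))
    ≡⟨ collect-terms (ℤtoℚ γ) f₀₁ (ℤtoℚ (I Z.+ + 1)) f₋₁ (ℤtoℚ J) f₀₀ (ℤtoℚ I) (ℤtoℚ (J - + 1)) ⟩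
  ℤtoℚ (I Z.+ + 1) Q.* f₋₁ Q.+ ℤtoℚ J Q.* f₀₀
    Q.+ (ℤtoℚ γ Q.+ Q.- ℕtoℚ 2 Q.* ℤtoℚ I Q.+ Q.- ℕtoℚ 4 Q.* ℤtoℚ (J - + 1)) Q.* f₀₁
    ≡⟨ cong (λ x → ℤtoℚ (I Z.+ + 1) Q.* f₋₁ Q.+ ℤtoℚ J Q.* f₀₀ Q.+ x Q.* f₀₁) (ℤtoℚ-linear γ I (J - + 1)) ⟩
  ℤtoℚ (I Z.+ + 1) Q.* f₋₁ Q.+ ℤtoℚ J Q.* f₀₀ Q.+ ℤtoℚ (γ - + 2 Z.* I - + 4 Z.* (J - + 1)) Q.* f₀₁ ∎
  where
  f₋₁ f₀₀ f₀₁ : ℚ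
  f₋₁ = f (I Z.+ + 1) (J - + 1)
  f₀₀ = f I J
  f₀₁ = f I (J - + 1)
  Lγ Lx Ly : Poly2
  Lγ = const2 (ℤtoℚ γ) *P2 var-y
  Lx = var-y *P2 (const2 1ℚ +P2 const2 (Q.- ℕtoℚ 2) *P2 var-x)
  Ly = var-y *P2 (const2 1ℚ +P2 const2 (Q.- ℕtoℚ 4) *P2 var-y)
  constant-part : coeff2ℤ (Lγ *P2 S) I J ≡ ℤtoℚ γ Q.* f₀₁
  constant-part = trans (coeff2ℤ-*ˡ Lγ S I J)
    (trans (QP.+-identityʳ _) (cong₂ Q._*_ (QP.*-identityʳ (ℤtoℚ γ)) (S≡f I (J - + 1))))
  x-part : coeff2ℤ (Lx *P2 ∂x S) I J ≡ ℤtoℚ (I Z.+ + 1) Q.* f₋₁ Q.+ Q.- ℕtoℚ 2 Q.* (ℤtoℚ I Q.* f₀₁)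
  x-part = trans (coeff2ℤ-*ˡ Lx (∂x S) I J)
    (trans (sum-of-two-terms (Q.- ℕtoℚ 2) (coeff2ℤ (∂x S) I (J - + 1)) (coeff2ℤ (∂x S) (I - + 1) (J - + 1)))
    (cong₂ (λ u v → u Q.+ Q.- ℕtoℚ 2 Q.* v)
      (trans (coeff2ℤ-∂x S I (J - + 1)) (cong (ℤtoℚ (I Z.+ + 1) Q.*_) (S≡f (I Z.+ + 1) (J - + 1))))
      (trans (coeff2ℤ-∂x-pred S I (J - + 1)) (cong (ℤtoℚ I Q.*_) (S≡f I (J - + 1))))))
  y-part : coeff2ℤ (Ly *P2 ∂y S) I J ≡ ℤtoℚ J Q.* f₀₀ Q.+ Q.- ℕtoℚ 4 Q.* (ℤtoℚ (J - + 1) Q.* f₀₁)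
  y-part = trans (coeff2ℤ-*ˡ Ly (∂y S) I J)
    (trans (sum-of-two-terms (Q.- ℕtoℚ 4) (coeff2ℤ (∂y S) I (J - + 1)) (coeff2ℤ (∂y S) I (J - + 1 - + 1)))
    (cong₂ (λ u v → u Q.+ Q.- ℕtoℚ 4 Q.* v)
      (trans (coeff2ℤ-∂y-pred S I J) (cong (ℤtoℚ J Q.*_) (S≡f I J)))
      (trans (coeff2ℤ-∂y-pred S I (J - + 1)) (cong (ℤtoℚ (J - + 1) Q.*_) (S≡f I (J - + 1))))))

sPoly-recurrence : (n : ℕ) → n ≥ 1 → sPoly n ≈P2 xyOperator (+ (2 * (3 * n ∸ 1))) (tPoly n)
sPoly-recurrence n@(suc _) n≥1 a b = begin
  coeff2 (sPoly n) a b
    ≡⟨ coeff2ℤ-sPoly n (+ a) (+ b) ⟩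
  s n (+ a) (+ b)
    ≡⟨ s-recurrence n n≥1 (+ a) (+ b) ⟩
  ℤtoℚ (+ a) Q.* t₀₁ Q.+ ℤtoℚ (+ b) Q.* t₁₀ Q.+ ℤtoℚ (+ 2 Z.* (+ (3 * n + 2) - + a - + 2 Z.* + b)) Q.* t₁₁
    ≡⟨ cong (λ e → ℤtoℚ (+ a) Q.* t₀₁ Q.+ ℤtoℚ (+ b) Q.* t₁₀ Q.+ ℤtoℚ e Q.* t₁₁) coefficient ⟩
  ℤtoℚ (+ a) Q.* t₀₁ Q.+ ℤtoℚ (+ b) Q.* t₁₀ Q.+ ℤtoℚ (γ - + 2 Z.* (+ a - + 1) - + 4 Z.* (+ b - + 1)) Q.* t₁₁
    ≡⟨ coeff2ℤ-xyOperator γ (tPoly n) (t n) (coeff2ℤ-tPoly n) (+ a) (+ b) ⟨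
  coeff2 (xyOperator γ (tPoly n)) a b ∎
  where
  γ : ℤ
  γ = + (2 * (3 * n ∸ 1))
  t₀₁ t₁₀ t₁₁ : ℚ
  t₀₁ = t n (+ a) (+ b - + 1)
  t₁₀ = t n (+ a - + 1) (+ b)
  t₁₁ = t n (+ a - + 1) (+ b - + 1)
  -- As n ≥ 1, + (3 * n ∸ 1) and + (3 * n) - + 1 agree by computation.
  coefficient : + 2 Z.* (+ (3 * n + 2) - + a - + 2 Z.* + b) ≡ γ - + 2 Z.* (+ a - + 1) - + 4 Z.* (+ b - + 1)
  coefficient = trans (cong (λ x → + 2 Z.* (x - + a - + 2 Z.* + b)) (ZP.pos-+ (3 * n) 2))
    (trans (regroup (+ (3 * n)) (+ a) (+ b)) (cong (λ x → x - + 2 Z.* (+ a - + 1) - + 4 Z.* (+ b - + 1)) (sym (ZP.pos-* 2 (3 * n ∸ 1)))))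
    where
    regroup : ∀ y i j → + 2 Z.* (y Z.+ + 2 - i - + 2 Z.* j) ≡ + 2 Z.* (y - + 1) - + 2 Z.* (i - + 1) - + 4 Z.* (j - + 1)
    regroup = solve-∀

tPoly-recurrence : (n : ℕ) → tPoly (suc n) ≈P2 yOperator (+ (2 * (3 * n + 1))) (sPoly n)
tPoly-recurrence n a b = begin
  coeff2 (tPoly (suc n)) a b
    ≡⟨ coeff2ℤ-tPoly (suc n) (+ a) (+ b) ⟩
  t (suc n) (+ a) (+ b)
    ≡⟨ t-recurrence n (+ a) (+ b) ⟩
  ℤtoℚ (+ a Z.+ + 1) Q.* s₋₁ Q.+ ℤtoℚ (+ b) Q.* s₀₀ Q.+ ℤtoℚ (+ 2 Z.* (+ (3 * n + 3) - + a - + 2 Z.* + b)) Q.* s₀₁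
    ≡⟨ cong (λ e → ℤtoℚ (+ a Z.+ + 1) Q.* s₋₁ Q.+ ℤtoℚ (+ b) Q.* s₀₀ Q.+ ℤtoℚ e Q.* s₀₁) coefficient ⟩
  ℤtoℚ (+ a Z.+ + 1) Q.* s₋₁ Q.+ ℤtoℚ (+ b) Q.* s₀₀ Q.+ ℤtoℚ (γ - + 2 Z.* + a - + 4 Z.* (+ b - + 1)) Q.* s₀₁
    ≡⟨ coeff2ℤ-yOperator γ (sPoly n) (s n) (coeff2ℤ-sPoly n) (+ a) (+ b) ⟨
  coeff2 (yOperator γ (sPoly n)) a b ∎
  where
  γ : ℤ
  γ = + (2 * (3 * n + 1))
  s₋₁ s₀₀ s₀₁ : ℚ
  s₋₁ = s n (+ a Z.+ + 1) (+ b - + 1)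
  s₀₀ = s n (+ a) (+ b)
  s₀₁ = s n (+ a) (+ b - + 1)
  coefficient : + 2 Z.* (+ (3 * n + 3) - + a - + 2 Z.* + b) ≡ γ - + 2 Z.* + a - + 4 Z.* (+ b - + 1)
  coefficient = trans (cong (λ x → + 2 Z.* (x - + a - + 2 Z.* + b)) (ZP.pos-+ (3 * n) 3))
    (trans (regroup (+ (3 * n)) (+ a) (+ b))
      (cong (λ x → x - + 2 Z.* + a - + 4 Z.* (+ b - + 1)) (sym (trans (ZP.pos-* 2 (3 * n + 1)) (cong (+ 2 Z.*_) (ZP.pos-+ (3 * n) 1))))))
    where
    regroup : ∀ y i j → + 2 Z.* (y Z.+ + 3 - i - + 2 Z.* j) ≡ + 2 Z.* (y Z.+ + 1) - + 2 Z.* i - + 4 Z.* (j - + 1)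
    regroup = solve-∀

tPoly-1 : tPoly 1 ≈P2 var-y
tPoly-1 a b = trans (coeff2ℤ-tPoly 1 (+ a) (+ b)) (t₁≡y a b)
  where
  t₁≡y : ∀ a b → t 1 (+ a) (+ b) ≡ coeff2 var-y a b
  t₁≡y 0 1 = refl
  t₁≡y 0 0 = t₁-vanishes (+ 0) (+ 0) (λ ())
  t₁≡y 0 (suc (suc b)) = t₁-vanishes (+ 0) (+ suc (suc b)) (λ ())
  t₁≡y (suc a) zero = t₁-vanishes (+ suc a) (+ 0) (λ ())
  t₁≡y (suc a) (suc b) = t₁-vanishes (+ suc a) (+ suc b) (λ ())

proposition15 :
    ((n : ℕ) → n ≥ 1 → (i j : ℤ) →
      s n i j ≡ (ℤtoℚ i Q.* t n i (j - + 1)) Q.+ (ℤtoℚ j Q.* t n (i - + 1) j)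
                  Q.+ (ℤtoℚ (+ 2 Z.* (+ (3 * n + 2) - i - + 2 Z.* j)) Q.* t n (i - + 1) (j - + 1)))
    × ((n : ℕ) → n ≥ 1 → (i j : ℤ) →
      t (suc n) i j ≡ (ℤtoℚ (i Z.+ + 1) Q.* s n (i Z.+ + 1) (j - + 1)) Q.+ (ℤtoℚ j Q.* s n i j)
                  Q.+ (ℤtoℚ (+ 2 Z.* (+ (3 * n + 3) - i - + 2 Z.* j)) Q.* s n i (j - + 1)))
    × (t 1 (+ 0) (+ 1) ≡ 1ℚ)
    × ((i j : ℤ) → ¬ (i ≡ + 0 × j ≡ + 1) → t 1 i j ≡ 0ℚ)
    × ((n : ℕ) → n ≥ 1 →
      sPoly n ≈P2 ((((const2 (ℕtoℚ (2 * (3 * n ∸ 1))) *P2 var-x) *P2 var-y) *P2 tPoly n)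
                   +P2 (((var-x *P2 var-y) *P2 (const2 1ℚ +P2 const2 (Q.- ℕtoℚ 2) *P2 var-x)) *P2 ∂x (tPoly n))
                   +P2 (((var-x *P2 var-y) *P2 (const2 1ℚ +P2 const2 (Q.- ℕtoℚ 4) *P2 var-y)) *P2 ∂y (tPoly n))))
    × ((n : ℕ) → n ≥ 1 →
      tPoly (suc n) ≈P2 (((const2 (ℕtoℚ (2 * (3 * n + 1))) *P2 var-y) *P2 sPoly n)
                   +P2 ((var-y *P2 (const2 1ℚ +P2 const2 (Q.- ℕtoℚ 2) *P2 var-x)) *P2 ∂x (sPoly n))
                   +P2 ((var-y *P2 (const2 1ℚ +P2 const2 (Q.- ℕtoℚ 4) *P2 var-y)) *P2 ∂y (sPoly n))))
    × (tPoly 1 ≈P2 var-y)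
proposition15 =
  s-recurrence , (λ n _ → t-recurrence n) , refl , t₁-vanishes ,
  sPoly-recurrence , (λ n _ → tPoly-recurrence n) , tPoly-1
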